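{- Let $G$ be a connected graph with $\Delta(G)\le 2$. Then: (i) $G$ is $(1,1,k)$-packing colorable for every $k\ge 1$; (ii) $G$ is $(1,2,2)$-packing colorable unless $G=C_5$; (iii) $G$ is $(2,2,2,2)$-packing colorable unless $G=C_5$; (iv) $G$ is $(1,2,4,5,k)$-packing colorable for every $k\ge 6$.
   Context: All graphs are finite, simple and undirected; $\Delta(G)$ is the maximum degree and $C_5$ is the cycle on $5$ vertices. For a non-decreasing sequence $S=(s_1,\dots,s_k)$ of positive integers, an $S$-packing coloring of $G$ is a partition of $V(G)$ into sets $V_1,\dots,V_k$ such that any two distinct vertices $u,v\in V_i$ satisfy $dist_G(u,v)>s_i$; $G$ is $S$-packing colorable if it admits one. -}

module Defs where

open import Data.Nat using (ℕ; zero; suc; _≤_; _%_)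
open import Data.Nat.Base using (_+_)
open import Data.Bool using (Bool; true; false; if_then_else_)
open import Data.Fin using (Fin; toℕ)
open import Data.List using (List; map; allFin; lookup; length)
open import Data.Nat.ListAction using (sum)
open import Data.Nat using (_≟_)
open import Relation.Nullary using (yes; no)
open import Data.Product using (Σ; _×_; _,_)
open import Relation.Binary.PropositionalEquality using (_≡_)
open import Relation.Nullary using (¬_)
open import Function.Bundles using (_↔_; Inverse)

record Graph : Set where
  field
    n      : ℕ
    Adj    : Fin n → Fin n → Bool
    sym    : ∀ u v → Adj u v ≡ Adj v u
    irrefl : ∀ u → Adj u u ≡ false

open Graph public

data Walk (G : Graph) : ℕ → Fin (n G) → Fin (n G) → Set where
  nil  : ∀ {u} → Walk G 0 u u
  cons : ∀ {l u w v} → Adj G u w ≡ true → Walk G l w v → Walk G (suc l) u v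

Dist≤ : (G : Graph) → ℕ → Fin (n G) → Fin (n G) → Set
Dist≤ G s u v = Σ ℕ λ l → l ≤ s × Walk G l u v

Connected : Graph → Set
Connected G = ∀ u v → Σ ℕ λ l → Walk G l u v

degree : (G : Graph) → Fin (n G) → ℕ
degree G v = sum (map (λ w → if Adj G v w then 1 else 0) (allFin (n G)))

MaxDeg≤ : Graph → ℕ → Set
MaxDeg≤ G d = ∀ v → degree G v ≤ d

PackingColorable : Graph → List ℕ → Set
PackingColorable G S =
  Σ (Fin (n G) → Fin (length S)) λ c →
    ∀ u v → ¬ (u ≡ v) → c u ≡ c v → ¬ Dist≤ G (lookup S (c u)) u v

C5adj : Fin 5 → Fin 5 → Bool
C5adj i j with (toℕ i + 1) % 5 ≟ toℕ j | (toℕ j + 1) % 5 ≟ toℕ i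
... | yes _ | _ = true
... | no _ | yes _ = true
... | no _ | no _ = false

IsC5 : Graph → Set
IsC5 G = Σ (Fin (n G) ↔ Fin 5) λ f →
  ∀ u v → Adj G u v ≡ C5adj (Inverse.to f u) (Inverse.to f v)

-- A connected graph of maximum degree at most 2 is a path or a cycle, so it has a cyclic layout:
-- an injective map into ℤ/N (N ≥ 3) sending edges to pairs at cyclic distance 1, given by the
-- levels of a breadth-first search from an end of the path, or from a vertex of the cycle after
-- deleting one of its edges. A path fits into cycles of every large length, so N = 5 only when G
-- is C₅. Walks of G map to walks around the cycle, hence every S-packing colouring of C_N pulls
-- back to G. These colourings are read cyclically off words of length N; a word is checked to be
-- spaced on three consecutive copies, and for all but a few small N it is a concatenation of
-- short blocks whose junctions are checked by computation. The colour whose distance k is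
-- unbounded occurs only at position 0, so its constraint never binds.

module Submission where

open import Defs hiding (sym)

open import Data.Bool using (Bool; true; false; T; not; _∧_; if_then_else_)
import Data.Bool.Properties as Bool
open import Data.Empty using (⊥; ⊥-elim)
open import Data.Fin as Fin using (#_; Fin; zero; suc; toℕ; fromℕ<)
import Data.Fin.Properties as Fin
open import Data.List using (List; []; _∷_; _++_; length; take; drop; concat; map; lookup; replicate; tabulate)
open import Data.List.Properties using (length-++; map-++; concat-++; ++-identityʳ; map-tabulate; tabulate-cong)
open import Data.List.Relation.Unary.All using (All; []; _∷_; all?)
import Data.List.Relation.Unary.All.Properties as All
open import Data.Nat
  using (ℕ; zero; suc; _+_; _∸_; _%_; _≤_; _<_; _≤ᵇ_; _≟_; _≤?_; _<?_; z≤n; s≤s; NonZero; pred)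
open import Data.Nat.DivMod using (%-distribˡ-+; m%n%n≡m%n; [m+n]%n≡m%n; m<n⇒m%n≡m; m%n<n; n%n≡0)
open import Data.Nat.ListAction using (sum)
open import Data.Nat.Properties
open import Algebra.Properties.CommutativeSemigroup +-commutativeSemigroup using (x∙yz≈y∙xz)
open import Data.Product as Prod using (Σ; _×_; _,_; proj₁; proj₂)
open import Data.Sum as Sum using (_⊎_; inj₁; inj₂; [_,_]′)
open import Function.Base using (_∘_; id)
open import Function.Bundles using (_⇔_; mk⇔; Equivalence; mk↔ₛ′)
open import Relation.Binary using (tri<; tri≈; tri>)
open import Relation.Binary.PropositionalEquality
open import Relation.Nullary using (¬_; yes; no; Dec; does; ¬?)
open import Relation.Nullary.Decidable
  using (True; isNo; toWitness; toWitnessFalse; from-yes; T?; _×-dec_; _⊎-dec_; _→-dec_; does-⇔; dec-true; dec-false)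

private
  variable
    A : Set
    i j m : ℕ

lookupOr : A → List A → ℕ → A
lookupOr z []       _       = z
lookupOr z (x ∷ xs) zero    = x
lookupOr z (x ∷ xs) (suc i) = lookupOr z xs i

lookupOr-++ˡ : ∀ (z : A) xs ys → i < length xs → lookupOr z (xs ++ ys) i ≡ lookupOr z xs i
lookupOr-++ˡ {i = zero}  z (x ∷ xs) ys _         = refl
lookupOr-++ˡ {i = suc i} z (x ∷ xs) ys (s≤s i<n) = lookupOr-++ˡ z xs ys i<n

lookupOr-++ʳ : ∀ (z : A) xs ys i → lookupOr z (xs ++ ys) (length xs + i) ≡ lookupOr z ys i
lookupOr-++ʳ z []       ys i = refl
lookupOr-++ʳ z (x ∷ xs) ys i = lookupOr-++ʳ z xs ys i

lookupOr-All : ∀ {P : A → Set} (z : A) {xs} → All P xs → i < length xs → P (lookupOr z xs i)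
lookupOr-All {i = zero}  z (px ∷ pxs) _         = px
lookupOr-All {i = suc i} z (px ∷ pxs) (s≤s i<n) = lookupOr-All z pxs i<n

take-++ˡ : ∀ m (xs ys : List A) → m ≤ length xs → take m (xs ++ ys) ≡ take m xs
take-++ˡ zero    xs       ys _         = refl
take-++ˡ (suc m) (x ∷ xs) ys (s≤s m≤n) = cong (x ∷_) (take-++ˡ m xs ys m≤n)

concat-map-++ : ∀ {I : Set} (f : I → List A) xs ys → concat (map f (xs ++ ys)) ≡ concat (map f xs) ++ concat (map f ys)
concat-map-++ f xs ys = trans (cong concat (map-++ f xs ys)) (sym (concat-++ (map f xs) (map f ys)))

T-∧⁻ : ∀ {a b} → T (a ∧ b) → T a × T b
T-∧⁻ = Equivalence.to Bool.T-∧

T-∧⁺ : ∀ {a b} → T a → T b → T (a ∧ b)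
T-∧⁺ p q = Equivalence.from Bool.T-∧ (p , q)

lookupOr-head-only : ∀ {c : A} z xs → All (_≢ c) (drop 1 xs) → i < length xs → lookupOr z xs i ≡ c → i ≡ 0
lookupOr-head-only {i = zero}  z xs       _     _         _ = refl
lookupOr-head-only {i = suc i} z (x ∷ xs) avoid (s≤s i<n) eq = ⊥-elim (lookupOr-All z avoid i<n eq)

length-concat-map : ∀ {I : Set} (blk : I → List A) (size : I → ℕ) → (∀ i → length (blk i) ≡ size i) →
                    ∀ ids → length (concat (map blk ids)) ≡ sum (map size ids)
length-concat-map blk size ∣blk∣ []        = refl
length-concat-map blk size ∣blk∣ (i ∷ ids) =
  trans (length-++ (blk i)) (cong₂ _+_ (∣blk∣ i) (length-concat-map blk size ∣blk∣ ids))

count : (Fin m → Bool) → ℕ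
count P = sum (tabulate λ x → if P x then 1 else 0)

degree≡count : ∀ G v → degree G v ≡ count (Adj G v)
degree≡count G v = cong sum (map-tabulate {n = n G} id (λ w → if Adj G v w then 1 else 0))

count-cong : ∀ {P Q : Fin m → Bool} → (∀ x → P x ≡ Q x) → count P ≡ count Q
count-cong P≗Q = cong sum (tabulate-cong λ x → cong (if_then 1 else 0) (P≗Q x))

-- Written with does rather than isNo so that (P without suc a) ∘ suc reduces to (P ∘ suc) without a.
_without_ : (Fin m → Bool) → Fin m → Fin m → Bool
(P without a) x = P x ∧ not (does (x Fin.≟ a))

count-without : ∀ (P : Fin m → Bool) a → P a ≡ true → count P ≡ suc (count (P without a))
count-without {suc m} P zero Pa rewrite Pa = cong suc (count-cong λ x → sym (Bool.∧-identityʳ (P (suc x))))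
count-without {suc m} P (suc a) Pa = begin
  ind (P zero) + count (P ∘ suc)          ≡⟨ cong (ind (P zero) +_) (count-without (P ∘ suc) a Pa) ⟩
  ind (P zero) + suc (count P′)           ≡⟨ +-suc (ind (P zero)) _ ⟩
  suc (ind (P zero) + count P′)           ≡⟨ cong (λ b → suc (ind b + count P′)) (Bool.∧-identityʳ (P zero)) ⟨
  suc (count (P without suc a))           ∎
  where
  open ≡-Reasoning
  P′ = (P ∘ suc) without a
  ind : Bool → ℕ
  ind b = if b then 1 else 0

without⁺ : ∀ (P : Fin m → Bool) {a b} → P b ≡ true → b ≢ a → (P without a) b ≡ true
without⁺ P {a} {b} Pb b≢a with b Fin.≟ a
... | yes b≡a = ⊥-elim (b≢a b≡a)
... | no _    = trans (Bool.∧-identityʳ (P b)) Pb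

without⁻ : ∀ (P : Fin m → Bool) {a b} → (P without a) b ≡ true → P b ≡ true × b ≢ a
without⁻ P {a} {b} h with P b | b Fin.≟ a
... | true | no b≢a = refl , b≢a

count≥1-witness : ∀ (P : Fin m → Bool) → 1 ≤ count P → Σ (Fin m) λ a → P a ≡ true
count≥1-witness {suc m} P 1≤count with P zero in Pz
... | true  = zero , Pz
... | false = let a , Pa = count≥1-witness (P ∘ suc) 1≤count in suc a , Pa

count≥1 : ∀ (P : Fin m → Bool) {a} → P a ≡ true → 1 ≤ count P
count≥1 P {a} Pa rewrite count-without P a Pa = s≤s z≤n

count≥2 : ∀ (P : Fin m → Bool) {a b} → P a ≡ true → P b ≡ true → a ≢ b → 2 ≤ count P
count≥2 P {a} Pa Pb a≢b rewrite count-without P a Pa = s≤s (count≥1 (P without a) (without⁺ P Pb (a≢b ∘ sym)))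

count≥3 : ∀ (P : Fin m → Bool) {a b c} → P a ≡ true → P b ≡ true → P c ≡ true →
          a ≢ b → a ≢ c → b ≢ c → 3 ≤ count P
count≥3 P {a} Pa Pb Pc a≢b a≢c b≢c rewrite count-without P a Pa =
  s≤s (count≥2 (P without a) (without⁺ P Pb (a≢b ∘ sym)) (without⁺ P Pc (a≢c ∘ sym)) b≢c)

count≥2-witnesses : ∀ (P : Fin m → Bool) → 2 ≤ count P →
                    Σ (Fin m) λ a → Σ (Fin m) λ b → a ≢ b × P a ≡ true × P b ≡ true
count≥2-witnesses P 2≤count with count≥1-witness P (≤-trans (s≤s z≤n) 2≤count)
... | a , Pa with count≥1-witness (P without a) (≤-pred (subst (2 ≤_) (count-without P a Pa) 2≤count))
...   | b , Pb∖a = let Pb , b≢a = without⁻ P Pb∖a in a , b , b≢a ∘ sym , Pa , Pb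

NoThreeNeighbours : Graph → Set
NoThreeNeighbours G = ∀ {x a b c} → Adj G x a ≡ true → Adj G x b ≡ true → Adj G x c ≡ true →
                      a ≢ b → a ≢ c → b ≢ c → ⊥

AtMostOneNeighbour : (G : Graph) → Fin (n G) → Set
AtMostOneNeighbour G v = ∀ {a b} → Adj G v a ≡ true → Adj G v b ≡ true → a ≡ b

maxDeg≤2⇒noThreeNeighbours : ∀ G → MaxDeg≤ G 2 → NoThreeNeighbours G
maxDeg≤2⇒noThreeNeighbours G Δ≤2 {x} xa xb xc a≢b a≢c b≢c =
  1+n≰n (≤-trans (count≥3 (Adj G x) xa xb xc a≢b a≢c b≢c) (subst (_≤ 2) (degree≡count G x) (Δ≤2 x)))

degree≤1⇒atMostOneNeighbour : ∀ G v → degree G v ≤ 1 → AtMostOneNeighbour G v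
degree≤1⇒atMostOneNeighbour G v deg≤1 {a} {b} va vb with a Fin.≟ b
... | yes a≡b = a≡b
... | no a≢b  = ⊥-elim (1+n≰n (≤-trans (count≥2 (Adj G v) va vb a≢b) (subst (_≤ 1) (degree≡count G v) deg≤1)))

degree≥2⇒twoNeighbours : ∀ G v → 2 ≤ degree G v →
                         Σ (Fin (n G)) λ a → Σ (Fin (n G)) λ b → a ≢ b × Adj G v a ≡ true × Adj G v b ≡ true
degree≥2⇒twoNeighbours G v 2≤deg = count≥2-witnesses (Adj G v) (subst (2 ≤_) (degree≡count G v) 2≤deg)

-- Levels of a breadth-first search

walk₀⇒≡ : ∀ {G u v} → Walk G 0 u v → u ≡ v
walk₀⇒≡ nil = refl

walk? : ∀ G l u v → Dec (Walk G l u v)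
walk? G zero u v with u Fin.≟ v
... | yes refl = yes nil
... | no u≢v   = no (u≢v ∘ walk₀⇒≡)
walk? G (suc l) u v with Fin.any? (λ w → (Adj G u w Bool.≟ true) ×-dec walk? G l w v)
... | yes (w , uw , W) = yes (cons uw W)
... | no ∄w            = no λ { (cons uw W) → ∄w (_ , uw , W) }

module Levels (K : Graph) (r : Fin (n K)) (root-lonely : AtMostOneNeighbour K r)
              (noThree : NoThreeNeighbours K) where

  Level : Fin (n K) → ℕ → Set
  Level v l = Walk K l v r × (∀ {j} → j < l → ¬ Walk K j v r)

  level-root : Level r 0
  level-root = nil , λ ()

  level-zero : ∀ {v} → Level v 0 → v ≡ r
  level-zero (W , _) = walk₀⇒≡ W

  private
    search : ∀ v l → Σ ℕ (Level v) ⊎ (∀ {j} → j < l → ¬ Walk K j v r)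
    search v zero = inj₂ λ ()
    search v (suc l) with search v l
    ... | inj₁ found = inj₁ found
    ... | inj₂ none with walk? K l v r
    ...   | yes W = inj₁ (l , W , none)
    ...   | no ¬W  = inj₂ λ j<1+l → [ none , (λ { refl → ¬W }) ]′ (m<1+n⇒m<n∨m≡n j<1+l)

  level-of-walk : ∀ {l v} → Walk K l v r → Σ ℕ (Level v)
  level-of-walk {l} {v} W = [ id , (λ none → ⊥-elim (none ≤-refl W)) ]′ (search v (suc l))

  level-functional : ∀ {v a b} → Level v a → Level v b → a ≡ b
  level-functional {a = a} {b} (Wa , min-a) (Wb , min-b) with <-cmp a b
  ... | tri< a<b _ _ = ⊥-elim (min-b a<b Wa)
  ... | tri≈ _ a≡b _ = a≡b
  ... | tri> _ _ b<a = ⊥-elim (min-a b<a Wb)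

  parent : ∀ {v l} → Level v (suc l) → Σ (Fin (n K)) λ w → Adj K v w ≡ true × Level w l
  parent (cons vw W , minimal) = _ , vw , W , λ j<l Wj → minimal (s≤s j<l) (cons vw Wj)

  level-adjacent-≤ : ∀ {u v a b} → Adj K u v ≡ true → Level u a → Level v b → b ≤ suc a
  level-adjacent-≤ {u} {v} {a} {b} uv (Wu , _) (_ , min-v) with b ≤? suc a
  ... | yes b≤1+a = b≤1+a
  ... | no b≰1+a  = ⊥-elim (min-v (≰⇒> b≰1+a) (cons (trans (Graph.sym K v u) uv) Wu))

  level-≢ : ∀ {x y a b} → Level x a → Level y b → a ≢ b → x ≢ y
  level-≢ lx ly a≢b refl = a≢b (level-functional lx ly)

  private
    -- A vertex has a neighbour below it, or is the root with at most one neighbour, so it has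
    -- at most one neighbour above it.
    no-two-children : ∀ l {z x y} → Level z l → Level x (suc l) → Level y (suc l) →
                      Adj K z x ≡ true → Adj K z y ≡ true → x ≢ y → ⊥
    no-two-children zero    lz lx ly zx zy x≢y with level-zero lz
    ... | refl = x≢y (root-lonely zx zy)
    no-two-children (suc l) lz lx ly zx zy x≢y with parent lz
    ... | w , zw , lw = noThree zx zy zw x≢y (level-≢ lx lw l+2≢l) (level-≢ ly lw l+2≢l)
      where
      l+2≢l : suc (suc l) ≢ l
      l+2≢l = >⇒≢ (m<n⇒m<1+n (n<1+n l))

  level-injective : ∀ {x y} l → Level x l → Level y l → x ≡ y
  level-injective zero lx ly = trans (level-zero lx) (sym (level-zero ly))
  level-injective {x} {y} (suc l) lx ly with parent lx | parent ly
  ... | x′ , xx′ , lx′ | y′ , yy′ , ly′ with level-injective l lx′ ly′ | x Fin.≟ y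
  ...   | _    | yes x≡y = x≡y
  ...   | refl | no x≢y  =
    ⊥-elim (no-two-children l lx′ lx ly (trans (Graph.sym K x′ x) xx′) (trans (Graph.sym K x′ y) yy′) x≢y)

  level-adjacent : ∀ {u v a b} → Adj K u v ≡ true → Level u a → Level v b → b ≡ suc a ⊎ a ≡ suc b
  level-adjacent {u} {v} uv lu lv
    with m≤n⇒m<n∨m≡n (level-adjacent-≤ uv lu lv)
       | m≤n⇒m<n∨m≡n (level-adjacent-≤ (trans (Graph.sym K v u) uv) lv lu)
  ... | inj₂ b≡1+a | _           = inj₁ b≡1+a
  ... | inj₁ _     | inj₂ a≡1+b  = inj₂ a≡1+b
  ... | inj₁ b<1+a | inj₁ a<1+b with ≤-antisym (≤-pred a<1+b) (≤-pred b<1+a)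
  ...   | refl with level-injective _ lu lv
  ...     | refl with trans (sym uv) (irrefl K u)
  ...       | ()

  level-downward : ∀ {v l} → Level v l → ∀ {j} → j ≤ l → Σ (Fin (n K)) λ x → Level x j
  level-downward {v} lv j≤l with m≤n⇒m<n∨m≡n j≤l
  ... | inj₂ refl = v , lv
  level-downward {l = suc l} lv j≤l | inj₁ j<1+l = level-downward (proj₂ (proj₂ (parent lv))) (≤-pred j<1+l)

module _ (G : Graph) (a b : Fin (n G)) where

  IsEdge : Fin (n G) → Fin (n G) → Set
  IsEdge u v = (u ≡ a × v ≡ b) ⊎ (u ≡ b × v ≡ a)

  isEdge? : ∀ u v → Dec (IsEdge u v)
  isEdge? u v = ((u Fin.≟ a) ×-dec (v Fin.≟ b)) ⊎-dec ((u Fin.≟ b) ×-dec (v Fin.≟ a))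

  IsEdge-sym : ∀ {u v} → IsEdge u v → IsEdge v u
  IsEdge-sym = Sum.swap ∘ Sum.map Prod.swap Prod.swap

  deleteEdge : Graph
  deleteEdge = record
    { n      = n G
    ; Adj    = λ u v → Adj G u v ∧ not (does (isEdge? u v))
    ; sym    = λ u v → cong₂ (λ x y → x ∧ not y) (Graph.sym G u v)
                              (does-⇔ (mk⇔ IsEdge-sym IsEdge-sym) (isEdge? u v) (isEdge? v u))
    ; irrefl = λ u → cong (_∧ _) (irrefl G u)
    }

  deleteEdge-⊆ : ∀ {u v} → Adj deleteEdge u v ≡ true → Adj G u v ≡ true
  deleteEdge-⊆ = Bool.∧-conicalˡ _ _

  deleteEdge-keeps : ∀ {u v} → Adj G u v ≡ true → ¬ IsEdge u v → Adj deleteEdge u v ≡ true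
  deleteEdge-keeps {u} {v} uv ¬e rewrite uv | dec-false (isEdge? u v) ¬e = refl

  deleteEdge-deletes : ∀ {u v} → IsEdge u v → Adj deleteEdge u v ≢ true
  deleteEdge-deletes {u} {v} e uv rewrite dec-true (isEdge? u v) e with trans (sym uv) (Bool.∧-zeroʳ (Adj G u v))
  ... | ()

  deleteEdge-noThree : NoThreeNeighbours G → NoThreeNeighbours deleteEdge
  deleteEdge-noThree noThree xa xb xc = noThree (deleteEdge-⊆ xa) (deleteEdge-⊆ xb) (deleteEdge-⊆ xc)

  deleteEdge-endpoint-lonely : NoThreeNeighbours G → ∀ {e o} → IsEdge e o → Adj G e o ≡ true →
                               AtMostOneNeighbour deleteEdge e
  deleteEdge-endpoint-lonely noThree {e} {o} edge eo {x} {y} ex ey with x Fin.≟ y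
  ... | yes x≡y = x≡y
  ... | no x≢y  = ⊥-elim (noThree eo (deleteEdge-⊆ ex) (deleteEdge-⊆ ey) (o≢ ex) (o≢ ey) x≢y)
    where
    o≢ : ∀ {z} → Adj deleteEdge e z ≡ true → o ≢ z
    o≢ ez refl = deleteEdge-deletes edge ez

-- Cyclic layouts

module Modulo (N : ℕ) .{{_ : NonZero N}} where

  infix 4 _≈_
  _≈_ : ℕ → ℕ → Set
  x ≈ y = x % N ≡ y % N

  ≈-+ʳ : ∀ {x y} c → x ≈ y → x + c ≈ y + c
  ≈-+ʳ {x} {y} c x≈y = begin
    (x + c) % N           ≡⟨ %-distribˡ-+ x c N ⟩
    (x % N + c % N) % N   ≡⟨ cong (λ t → (t + c % N) % N) x≈y ⟩
    (y % N + c % N) % N   ≡⟨ %-distribˡ-+ y c N ⟨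
    (y + c) % N           ∎
    where open ≡-Reasoning

  ≈-suc : ∀ {x y} → x ≈ y → suc x ≈ suc y
  ≈-suc {x} {y} x≈y = begin
    suc x % N   ≡⟨ cong (_% N) (+-comm 1 x) ⟩
    (x + 1) % N ≡⟨ ≈-+ʳ 1 x≈y ⟩
    (y + 1) % N ≡⟨ cong (_% N) (+-comm y 1) ⟩
    suc y % N   ∎
    where open ≡-Reasoning

  ≈-suc-injective : ∀ {x y} → suc x ≈ suc y → x ≈ y
  ≈-suc-injective {x} {y} sx≈sy = begin
    x % N                 ≡⟨ [m+n]%n≡m%n x N ⟨
    (x + N) % N           ≡⟨ cong (_% N) (wrap x) ⟨
    (suc x + pred N) % N  ≡⟨ ≈-+ʳ (pred N) sx≈sy ⟩
    (suc y + pred N) % N  ≡⟨ cong (_% N) (wrap y) ⟩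
    (y + N) % N           ≡⟨ [m+n]%n≡m%n y N ⟩
    y % N                 ∎
    where
    open ≡-Reasoning
    wrap : ∀ x → suc x + pred N ≡ x + N
    wrap x = trans (sym (+-suc x (pred N))) (cong (x +_) (suc-pred N))

  ≈⇒≡ : ∀ {x y} → x < N → y < N → x ≈ y → x ≡ y
  ≈⇒≡ x<N y<N x≈y = trans (sym (m<n⇒m%n≡m x<N)) (trans x≈y (m<n⇒m%n≡m y<N))

  CycleAdjacent : ℕ → ℕ → Set
  CycleAdjacent p q = suc p ≈ q ⊎ suc q ≈ p

  CycleDist≤ : ℕ → ℕ → ℕ → Set
  CycleDist≤ l p q = Σ ℕ λ d → d ≤ l × (p + d ≈ q ⊎ q + d ≈ p)

  cycleDist-mono : ∀ {l l′ p q} → l ≤ l′ → CycleDist≤ l p q → CycleDist≤ l′ p q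
  cycleDist-mono l≤l′ (d , d≤l , h) = d , ≤-trans d≤l l≤l′ , h

  cycleDist-step : ∀ {l p q r} → CycleAdjacent p q → CycleDist≤ l q r → CycleDist≤ (suc l) p r
  cycleDist-step {p = p} {q} {r} (inj₁ sp≈q) (d , d≤l , inj₁ q+d≈r) =
    suc d , s≤s d≤l , inj₁ (trans (cong (_% N) (+-suc p d)) (trans (≈-+ʳ d sp≈q) q+d≈r))
  cycleDist-step {p = p} {q} {r} (inj₂ sq≈p) (d , d≤l , inj₂ r+d≈q) =
    suc d , s≤s d≤l , inj₂ (trans (cong (_% N) (+-suc r d)) (trans (≈-suc r+d≈q) sq≈p))
  cycleDist-step {p = p} {q} {r} (inj₂ sq≈p) (zero , _ , inj₁ q+0≈r) =
    1 , s≤s z≤n , inj₂ (trans (cong (_% N) (+-comm r 1))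
                          (trans (≈-suc (trans (sym q+0≈r) (cong (_% N) (+-identityʳ q)))) sq≈p))
  cycleDist-step {p = p} {q} {r} (inj₂ sq≈p) (suc d , d<l , inj₁ q+sd≈r) =
    d , m<n⇒m≤1+n d<l , inj₁ (trans (≈-+ʳ d (sym sq≈p)) (trans (cong (_% N) (sym (+-suc q d))) q+sd≈r))
  cycleDist-step {p = p} {q} {r} (inj₁ sp≈q) (zero , _ , inj₂ r+0≈q) =
    1 , s≤s z≤n , inj₁ (trans (cong (_% N) (+-comm p 1))
                          (trans sp≈q (trans (sym r+0≈q) (cong (_% N) (+-identityʳ r)))))
  cycleDist-step {p = p} {q} {r} (inj₁ sp≈q) (suc d , d<l , inj₂ r+sd≈q) =
    d , m<n⇒m≤1+n d<l , inj₂ (≈-suc-injective (trans (cong (_% N) (sym (+-suc r d))) (trans r+sd≈q (sym sp≈q))))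

  CyclicPacking : (S : List ℕ) → (ℕ → Fin (length S)) → Set
  CyclicPacking S f = ∀ p q → f p ≡ f q → ¬ p ≈ q → ¬ CycleDist≤ (lookup S (f p)) p q

record CyclicLayout (G : Graph) (N : ℕ) .{{_ : NonZero N}} : Set where
  field
    pos           : Fin (n G) → ℕ
    pos<N         : ∀ v → pos v < N
    pos-injective : ∀ u v → pos u ≡ pos v → u ≡ v
    pos-adjacent  : ∀ u v → Adj G u v ≡ true → Modulo.CycleAdjacent N (pos u) (pos v)

module _ {G : Graph} {N : ℕ} .{{_ : NonZero N}} (L : CyclicLayout G N) where
  open CyclicLayout L
  open Modulo N

  walk-cycleDist : ∀ {l u v} → Walk G l u v → CycleDist≤ l (pos u) (pos v)
  walk-cycleDist nil        = 0 , z≤n , inj₁ (cong (_% N) (+-identityʳ _))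
  walk-cycleDist (cons e W) = cycleDist-step (pos-adjacent _ _ e) (walk-cycleDist W)

  layout-packing : ∀ {S} f → CyclicPacking S f → PackingColorable G S
  layout-packing f pack = f ∘ pos , λ u v u≢v same (l , l≤s , W) →
    pack (pos u) (pos v) same (u≢v ∘ pos-injective u v ∘ ≈⇒≡ (pos<N u) (pos<N v))
      (cycleDist-mono l≤s (walk-cycleDist W))

-- Connected graphs of maximum degree 2 have cyclic layouts

C5adj⇔cycleAdjacent : ∀ i j → C5adj i j ≡ true ⇔ Modulo.CycleAdjacent 5 (toℕ i) (toℕ j)
C5adj⇔cycleAdjacent = from-yes (Fin.all? λ i → Fin.all? λ j → equivalence? (C5adj i j ≡ true) _
  (C5adj i j Bool.≟ true) (((suc (toℕ i) % 5) ≟ (toℕ j % 5)) ⊎-dec ((suc (toℕ j) % 5) ≟ (toℕ i % 5))))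
  where
  equivalence? : ∀ (A B : Set) → Dec A → Dec B → Dec (A ⇔ B)
  equivalence? A B a? b? with (a? →-dec b?) ×-dec (b? →-dec a?)
  ... | yes (to , from) = yes (mk⇔ to from)
  ... | no ¬both        = no λ A⇔B → ¬both (Equivalence.to A⇔B , Equivalence.from A⇔B)

layout-isC5 : ∀ {G N} .{{_ : NonZero N}} (L : CyclicLayout G N) → N ≡ 5 → let open CyclicLayout L in
              (∀ {j} → j < N → Σ (Fin (n G)) λ v → pos v ≡ j) →
              (∀ u v → Modulo.CycleAdjacent N (pos u) (pos v) → Adj G u v ≡ true) → IsC5 G
layout-isC5 {G} L refl onto reflect = mk↔ₛ′ to from to∘from from∘to , adjacency
  where
  open CyclicLayout L
  to : Fin (n G) → Fin 5
  to u = fromℕ< (pos<N u)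
  toℕ∘to : ∀ u → toℕ (to u) ≡ pos u
  toℕ∘to u = Fin.toℕ-fromℕ< (pos<N u)
  from : Fin 5 → Fin (n G)
  from i = proj₁ (onto (Fin.toℕ<n i))
  to∘from : ∀ i → to (from i) ≡ i
  to∘from i = Fin.toℕ-injective (trans (toℕ∘to (from i)) (proj₂ (onto (Fin.toℕ<n i))))
  from∘to : ∀ u → from (to u) ≡ u
  from∘to u = pos-injective _ _ (trans (proj₂ (onto (Fin.toℕ<n (to u)))) (toℕ∘to u))
  adjacency : ∀ u v → Adj G u v ≡ C5adj (to u) (to v)
  adjacency u v = Bool.⇔→≡ (mk⇔
    (λ uv → Equivalence.from (C5adj⇔cycleAdjacent (to u) (to v))
              (subst₂ (Modulo.CycleAdjacent 5) (sym (toℕ∘to u)) (sym (toℕ∘to v)) (pos-adjacent u v uv)))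
    (λ c → reflect u v (subst₂ (Modulo.CycleAdjacent 5) (toℕ∘to u) (toℕ∘to v)
              (Equivalence.to (C5adj⇔cycleAdjacent (to u) (to v)) c))))

≤-sum-tabulate : ∀ {m} (f : Fin m → ℕ) i → f i ≤ sum (tabulate f)
≤-sum-tabulate f zero    = m≤m+n _ _
≤-sum-tabulate f (suc i) = ≤-trans (≤-sum-tabulate (f ∘ suc) i) (m≤n+m _ _)

module PathLayout (G : Graph) (r : Fin (n G)) (r-lonely : AtMostOneNeighbour G r)
                  (noThree : NoThreeNeighbours G) where
  open Levels G r r-lonely noThree

  -- Any length exceeding every level would do; this one is moreover never 5.
  layout : (d : Fin (n G) → ℕ) → (∀ v → Level v (d v)) → CyclicLayout G (6 + sum (tabulate d))
  layout d d-level = record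
    { pos           = d
    ; pos<N         = λ v → s≤s (≤-trans (≤-sum-tabulate d v) (m≤n+m _ 5))
    ; pos-injective = λ u v du≡dv → level-injective (d u) (d-level u) (subst (Level v) (sym du≡dv) (d-level v))
    ; pos-adjacent  = λ u v uv → Sum.map (cong (_% N) ∘ sym) (cong (_% N) ∘ sym)
                                          (level-adjacent uv (d-level u) (d-level v))
    }
    where
    N = 6 + sum (tabulate d)

pathLayout : ∀ G → Connected G → NoThreeNeighbours G → ∀ r → AtMostOneNeighbour G r →
             Σ ℕ λ m → CyclicLayout G (6 + m)
pathLayout G conn noThree r r-lonely = _ , layout (proj₁ ∘ level) (proj₂ ∘ level)
  where
  open PathLayout G r r-lonely noThree
  open Levels G r r-lonely noThree
  level : ∀ v → Σ ℕ (Level v)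
  level v = level-of-walk (proj₂ (conn v r))

-- Deleting the edge r r′ leaves a path from r to r′ whose levels number the cycle, from r at
-- level 0 to r′ at level D.
module CycleLayout (G : Graph) (conn : Connected G) (noThree : NoThreeNeighbours G)
                   (two : ∀ v → Σ (Fin (n G)) λ a → Σ (Fin (n G)) λ b →
                                a ≢ b × Adj G v a ≡ true × Adj G v b ≡ true)
                   (r : Fin (n G)) where

  r′ : Fin (n G)
  r′ = proj₁ (two r)

  rr′ : Adj G r r′ ≡ true
  rr′ = proj₁ (proj₂ (proj₂ (proj₂ (two r))))

  r≢r′ : r ≢ r′
  r≢r′ r≡r′ with trans (sym rr′) (subst (λ x → Adj G r x ≡ false) r≡r′ (irrefl G r))
  ... | ()

  H : Graph
  H = deleteEdge G r r′

  H-sym : ∀ {u v} → Adj H u v ≡ true → Adj H v u ≡ true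
  H-sym {u} {v} = trans (Graph.sym H v u)

  r-lonely : AtMostOneNeighbour H r
  r-lonely = deleteEdge-endpoint-lonely G r r′ noThree (inj₁ (refl , refl)) rr′

  r′-lonely : AtMostOneNeighbour H r′
  r′-lonely = deleteEdge-endpoint-lonely G r r′ noThree (inj₂ (refl , refl)) (trans (Graph.sym G r′ r) rr′)

  open Levels H r r-lonely (deleteEdge-noThree G r r′ noThree)

  private
    neighbour-level : ∀ {x y l} → Adj H x y ≡ true → Level x l →
                      Σ ℕ λ b → Level y b × (b ≡ suc l ⊎ l ≡ suc b)
    neighbour-level xy lx with level-of-walk (cons (H-sym xy) (proj₁ lx))
    ... | b , ly = b , ly , level-adjacent xy lx ly

    up-from-root : ∀ {y} → y ≢ r′ → Adj G r y ≡ true → Σ (Fin (n G)) λ y → Level y 1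
    up-from-root {y} y≢r′ ry
      with neighbour-level (deleteEdge-keeps G r r′ ry [ y≢r′ ∘ proj₂ , r≢r′ ∘ proj₁ ]′) level-root
    ... | _ , ly , inj₁ refl = y , ly

    H-keeps : ∀ {x y l} → Level x (suc l) → x ≢ r′ → Adj G x y ≡ true → Adj H x y ≡ true
    H-keeps lx x≢r′ xy =
      deleteEdge-keeps G r r′ xy [ level-≢ lx level-root (λ ()) ∘ proj₁ , x≢r′ ∘ proj₁ ]′

  -- Both neighbours of x survive in H unless x = r, and at most one of them lies below x.
  climb : ∀ {x l} → Level x l → x ≢ r′ → Σ (Fin (n G)) λ y → Level y (suc l)
  climb {x} {zero} lx x≢r′ with level-zero lx | two x
  ... | refl | p , q , p≢q , rp , rq with p Fin.≟ r′
  ...   | yes refl = up-from-root (p≢q ∘ sym) rq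
  ...   | no p≢r′  = up-from-root p≢r′ rp
  climb {x} {suc l} lx x≢r′ with two x
  ... | p , q , p≢q , xp , xq
      with neighbour-level (H-keeps lx x≢r′ xp) lx | neighbour-level (H-keeps lx x≢r′ xq) lx
  ...   | _ , lp , inj₁ refl | _                  = p , lp
  ...   | _ , _  , inj₂ _    | _ , lq , inj₁ refl = q , lq
  ...   | _ , lp , inj₂ refl | _ , lq , inj₂ refl = ⊥-elim (p≢q (level-injective l lp lq))

  Reach : Set
  Reach = Σ ℕ λ l → Walk H l r′ r

  -- If r′ were never reached, the levels 0, …, n G would all be inhabited, contradicting the
  -- pigeonhole principle; stating it as a disjunction keeps the argument constructive.
  reach-or-levels : ∀ l → Reach ⊎ (∀ {j} → j ≤ l → Σ (Fin (n G)) λ x → Level x j)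
  reach-or-levels zero = inj₂ λ { z≤n → r , level-root }
  reach-or-levels (suc l) with reach-or-levels l
  ... | inj₁ reached = inj₁ reached
  ... | inj₂ levels with levels ≤-refl
  ...   | x , lx with x Fin.≟ r′
  ...     | yes refl = inj₁ (l , proj₁ lx)
  ...     | no x≢r′  =
    inj₂ λ j≤1+l → [ levels ∘ ≤-pred , (λ { refl → climb lx x≢r′ }) ]′ (m≤n⇒m<n∨m≡n j≤1+l)

  reach : Reach
  reach with reach-or-levels (n G)
  ... | inj₁ reached = reached
  ... | inj₂ levels with Fin.pigeonhole (n<1+n (n G)) (λ i → proj₁ (levels (≤-pred (Fin.toℕ<n i))))
  ...   | i , j , i<j , same =
    ⊥-elim (<⇒≢ i<j (level-functional (proj₂ (levels _))
                                      (subst (λ x → Level x (toℕ j)) (sym same) (proj₂ (levels _)))))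

  H-walk : ∀ {l v} → Walk G l v r → Σ ℕ λ l′ → Walk H l′ v r
  H-walk nil = 0 , nil
  H-walk (cons {u = v} {w = w} vw W) with isEdge? G r r′ v w
  ... | yes (inj₁ (refl , refl)) = 0 , nil
  ... | yes (inj₂ (refl , refl)) = reach
  ... | no ¬edge = let l′ , W′ = H-walk W in suc l′ , cons (deleteEdge-keeps G r r′ vw ¬edge) W′

  -- The levels are a parameter so that the search computing them is never unfolded.
  module _ (d : Fin (n G) → ℕ) (d-level : ∀ v → Level v (d v)) where

    D : ℕ
    D = d r′

    private
      d-injective : ∀ u v → d u ≡ d v → u ≡ v
      d-injective u v du≡dv = level-injective (d u) (d-level u) (subst (Level v) (sym du≡dv) (d-level v))

      d-root : ∀ {v} → d v ≡ 0 → v ≡ r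
      d-root {v} dv≡0 = level-zero (subst (Level v) dv≡0 (d-level v))

      D-shape : ∀ {l} → Level r′ l → Σ ℕ λ m → l ≡ 2 + m
      D-shape {zero}        lr′ = ⊥-elim (r≢r′ (sym (level-zero lr′)))
      D-shape {suc zero}    lr′ with parent lr′
      ... | z , r′z , lz with level-zero lz
      ...   | refl = ⊥-elim (deleteEdge-deletes G r r′ (inj₂ (refl , refl)) r′z)
      D-shape {suc (suc m)} _   = m , refl

      nothing-above : ∀ {y} → Level y (suc D) → ⊥
      nothing-above ly with parent ly | D-shape (d-level r′)
      ... | y′ , yy′ , ly′ | m , D≡2+m
          with level-injective D ly′ (d-level r′) | parent (subst (Level r′) D≡2+m (d-level r′))
      ...   | refl | z , r′z , lz =
        level-≢ ly lz (λ 1+D≡1+m → <⇒≢ (m<n⇒m<1+n (n<1+n m)) (trans (sym (suc-injective 1+D≡1+m)) D≡2+m))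
          (r′-lonely (H-sym yy′) r′z)

    d≤D : ∀ v → d v ≤ D
    d≤D v with d v ≤? D
    ... | yes dv≤D = dv≤D
    ... | no dv≰D  = ⊥-elim (nothing-above (proj₂ (level-downward (d-level v) (≰⇒> dv≰D))))

    open Modulo (suc D)

    private
      d<N : ∀ v → d v < suc D
      d<N = s≤s ∘ d≤D

      d-r : d r ≡ 0
      d-r = level-functional (d-level r) level-root

      top-wraps : ∀ {u} → d u ≡ D → suc (d u) ≈ 0
      top-wraps du≡D = trans (cong (λ x → suc x % suc D) du≡D) (n%n≡0 (suc D))

      r′-wraps : suc (d r′) ≈ d r
      r′-wraps = trans (top-wraps refl) (sym (cong (_% suc D) d-r))

      forward : ∀ {u v} → suc (d u) ≈ d v → Adj G u v ≡ true
      forward {u} {v} h with m≤n⇒m<n∨m≡n (d≤D u)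
      ... | inj₁ du<D with parent (subst (Level v) (sym (≈⇒≡ (s≤s du<D) (d<N v) h)) (d-level v))
      ...   | w , vw , lw with level-injective (d u) lw (d-level u)
      ...     | refl = trans (Graph.sym G u v) (deleteEdge-⊆ G r r′ vw)
      forward {u} {v} h | inj₂ du≡D
        with d-injective u r′ du≡D | d-root (≈⇒≡ (d<N v) (s≤s z≤n) (trans (sym h) (top-wraps du≡D)))
      ... | refl | refl = trans (Graph.sym G r′ r) rr′

    layout : CyclicLayout G (suc D)
    layout = record { pos = d ; pos<N = d<N ; pos-injective = d-injective ; pos-adjacent = adjacent }
      where
      adjacent : ∀ u v → Adj G u v ≡ true → CycleAdjacent (d u) (d v)
      adjacent u v uv with isEdge? G r r′ u v
      ... | yes (inj₁ (refl , refl)) = inj₂ r′-wraps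
      ... | yes (inj₂ (refl , refl)) = inj₁ r′-wraps
      ... | no ¬edge = Sum.map (cong (_% suc D) ∘ sym) (cong (_% suc D) ∘ sym)
                         (level-adjacent (deleteEdge-keeps G r r′ uv ¬edge) (d-level u) (d-level v))

    onto : ∀ {j} → j < suc D → Σ (Fin (n G)) λ v → d v ≡ j
    onto j<N with level-downward (d-level r′) (≤-pred j<N)
    ... | x , lx = x , level-functional (d-level x) lx

    reflect : ∀ u v → CycleAdjacent (d u) (d v) → Adj G u v ≡ true
    reflect u v (inj₁ h) = forward h
    reflect u v (inj₂ h) = trans (Graph.sym G u v) (forward h)

    layout-of-levels : Σ ℕ λ m → CyclicLayout G (3 + m) × (3 + m ≡ 5 → IsC5 G)
    layout-of-levels with D-shape (d-level r′)
    ... | m , D≡2+m = m , subst (λ D → CyclicLayout G (suc D)) D≡2+m layout ,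
                      λ N≡5 → layout-isC5 layout (trans (cong suc D≡2+m) N≡5) onto reflect

  cycleLayout : Σ ℕ λ m → CyclicLayout G (3 + m) × (3 + m ≡ 5 → IsC5 G)
  cycleLayout = layout-of-levels (proj₁ ∘ level) (proj₂ ∘ level)
    where
    level : ∀ v → Σ ℕ (Level v)
    level v = level-of-walk (proj₂ (H-walk (proj₂ (conn v r))))

emptyLayout : ∀ {G} → ¬ Fin (n G) → CyclicLayout G 6
emptyLayout ∄v = record
  { pos = ⊥-elim ∘ ∄v ; pos<N = ⊥-elim ∘ ∄v ; pos-injective = ⊥-elim ∘ ∄v ; pos-adjacent = ⊥-elim ∘ ∄v }

cyclicLayout : ∀ G → Connected G → MaxDeg≤ G 2 → Σ ℕ λ m → CyclicLayout G (3 + m) × (3 + m ≡ 5 → IsC5 G)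
cyclicLayout G conn Δ≤2 = by-cases (Fin.any? λ v → degree G v ≤? 1) (vertex (n G))
  where
  noThree : NoThreeNeighbours G
  noThree = maxDeg≤2⇒noThreeNeighbours G Δ≤2
  vertex : ∀ k → Fin k ⊎ ¬ Fin k
  vertex zero    = inj₂ λ ()
  vertex (suc k) = inj₁ zero
  by-cases : Dec (Σ (Fin (n G)) λ v → degree G v ≤ 1) → Fin (n G) ⊎ ¬ Fin (n G) →
             Σ ℕ λ m → CyclicLayout G (3 + m) × (3 + m ≡ 5 → IsC5 G)
  by-cases (yes (r , deg≤1)) _ =
    let m , L = pathLayout G conn noThree r (degree≤1⇒atMostOneNeighbour G r deg≤1) in 3 + m , L , λ ()
  by-cases (no ∄leaf) (inj₁ r) =
    CycleLayout.cycleLayout G conn noThree (λ v → degree≥2⇒twoNeighbours G v (≰⇒> (∄leaf ∘ (v ,_)))) r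
  by-cases (no _) (inj₂ ∄v) = 3 , emptyLayout ∄v , λ ()

-- Spaced words

module Spacing {k : ℕ} (s : Fin k → ℕ) where

  clearOf : ℕ → Fin k → List (Fin k) → Bool
  clearOf zero    x ys       = true
  clearOf (suc j) x []       = true
  clearOf (suc j) x (y ∷ ys) = isNo (y Fin.≟ x) ∧ clearOf j x ys

  spaced : List (Fin k) → Bool
  spaced []       = true
  spaced (x ∷ xs) = clearOf (s x) x xs ∧ spaced xs

  clearOf-sound : ∀ z j x ys → T (clearOf j x ys) → i < j → i < length ys → lookupOr z ys i ≢ x
  clearOf-sound {zero}  z (suc j) x (y ∷ ys) h _ _ =
    toWitnessFalse {a? = y Fin.≟ x} (proj₁ (T-∧⁻ {isNo (y Fin.≟ x)} h))
  clearOf-sound {suc i} z (suc j) x (y ∷ ys) h (s≤s i<j) (s≤s i<n) =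
    clearOf-sound z j x ys (proj₂ (T-∧⁻ {isNo (y Fin.≟ x)} h)) i<j i<n

  spaced-sound : ∀ z xs {i d} → T (spaced xs) → 0 < d → d ≤ s (lookupOr z xs i) → i + d < length xs →
                 lookupOr z xs (i + d) ≢ lookupOr z xs i
  spaced-sound z (x ∷ xs) {zero}  {suc d} h _ d≤ (s≤s i+d<n) =
    clearOf-sound z (s x) x xs (proj₁ (T-∧⁻ {clearOf (s x) x xs} h)) d≤ i+d<n
  spaced-sound z (x ∷ xs) {suc i}         h 0<d d≤ (s≤s i+d<n) =
    spaced-sound z xs (proj₂ (T-∧⁻ {clearOf (s x) x xs} h)) 0<d d≤ i+d<n

  clearOf-take : ∀ j m x ys → j ≤ m → clearOf j x (take m ys) ≡ clearOf j x ys
  clearOf-take zero    m       x ys       _         = refl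
  clearOf-take (suc j) (suc m) x []       _         = refl
  clearOf-take (suc j) (suc m) x (y ∷ ys) (s≤s j≤m) = cong (_ ∧_) (clearOf-take j m x ys j≤m)

  clearOf-++-take : ∀ j m x xs ys → j ≤ m → clearOf j x (xs ++ take m ys) ≡ clearOf j x (xs ++ ys)
  clearOf-++-take j       m x []       ys j≤m = clearOf-take j m x ys j≤m
  clearOf-++-take zero    m x (y ∷ xs) ys _   = refl
  clearOf-++-take (suc j) m x (y ∷ xs) ys j≤m =
    cong (_ ∧_) (clearOf-++-take j m x xs ys (≤-trans (n≤1+n j) j≤m))

  module Window (m : ℕ) (s≤m : ∀ c → s c ≤ m) where

    spaced-++ : ∀ xs ys → T (spaced (xs ++ take m ys)) → T (spaced ys) → T (spaced (xs ++ ys))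
    spaced-++ []       ys _ h = h
    spaced-++ (x ∷ xs) ys h hys with T-∧⁻ {clearOf (s x) x (xs ++ take m ys)} h
    ... | clear , rest = T-∧⁺ (subst T (clearOf-++-take (s x) m x xs ys (s≤m x)) clear) (spaced-++ xs ys rest hys)

    fits : List (Fin k) → List (Fin k) → Bool
    fits xs ys = spaced (xs ++ take m ys) ∧ spaced xs ∧ (m ≤ᵇ length xs)

    module _ (xs ys : List (Fin k)) (h : T (fits xs ys)) where

      fits-spaced-++ : T (spaced (xs ++ take m ys))
      fits-spaced-++ = proj₁ (T-∧⁻ {spaced (xs ++ take m ys)} h)

      fits-spaced : T (spaced xs)
      fits-spaced = proj₁ (T-∧⁻ {spaced xs} (proj₂ (T-∧⁻ {spaced (xs ++ take m ys)} h)))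

      fits-length : m ≤ length xs
      fits-length = ≤ᵇ⇒≤ m _ (proj₂ (T-∧⁻ {spaced xs} (proj₂ (T-∧⁻ {spaced (xs ++ take m ys)} h))))

    Compatible : ∀ {n} → (Fin n → List (Fin k)) → Set
    Compatible blk = ∀ i j → T (fits (blk i) (blk j))

    compatible? : ∀ {n} (blk : Fin n → List (Fin k)) → Dec (Compatible blk)
    compatible? blk = Fin.all? λ i → Fin.all? λ j → T? (fits (blk i) (blk j))

    spaced-concat : ∀ {n} (blk : Fin n → List (Fin k)) → Compatible blk →
                    ∀ ids → T (spaced (concat (map blk ids)))
    spaced-concat blk ok []            = _
    spaced-concat blk ok (i ∷ [])      =
      subst (T ∘ spaced) (sym (++-identityʳ (blk i))) (fits-spaced (blk i) (blk i) (ok i i))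
    spaced-concat blk ok (i ∷ j ∷ ids) =
      spaced-++ (blk i) (blk j ++ concat (map blk ids))
        (subst (λ t → T (spaced (blk i ++ t))) (sym (take-++ˡ m (blk j) _ (fits-length (blk j) (blk j) (ok j j))))
          (fits-spaced-++ (blk i) (blk j) (ok i j)))
        (spaced-concat blk ok (j ∷ ids))

    spaced-cycle : ∀ {n} (blk : Fin n → List (Fin k)) → Compatible blk →
                   ∀ ids → let w = concat (map blk ids) in T (spaced (w ++ w ++ w))
    spaced-cycle blk ok ids = subst (T ∘ spaced) three-copies (spaced-concat blk ok (ids ++ ids ++ ids))
      where
      w = concat (map blk ids)
      three-copies : concat (map blk (ids ++ ids ++ ids)) ≡ w ++ w ++ w
      three-copies = trans (concat-map-++ blk ids (ids ++ ids)) (cong (w ++_) (concat-map-++ blk ids ids))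

module CyclicWord (S : List ℕ) (s : Fin (length S) → ℕ) (N : ℕ) .{{_ : NonZero N}}
                  (z : Fin (length S)) (w : List (Fin (length S))) (∣w∣≡N : length w ≡ N) where
  open Modulo N
  open Spacing s

  cyclic : ℕ → Fin (length S)
  cyclic p = lookupOr z w (p % N)

  private
    periodic : ∀ j → j < N → lookupOr z w j ≡ cyclic j
    periodic j j<N = cong (lookupOr z w) (sym (m<n⇒m%n≡m j<N))

    periodic-++ : ∀ ys M → (∀ j → j < M → lookupOr z ys j ≡ cyclic j) →
                  ∀ j → j < N + M → lookupOr z (w ++ ys) j ≡ cyclic j
    periodic-++ ys M hys j j<N+M with j <? N
    ... | yes j<N = trans (lookupOr-++ˡ z w ys (subst (j <_) (sym ∣w∣≡N) j<N)) (periodic j j<N)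
    ... | no j≮N = begin
      lookupOr z (w ++ ys) j               ≡⟨ cong (lookupOr z (w ++ ys)) (sym j≡N+r) ⟩
      lookupOr z (w ++ ys) (N + r)         ≡⟨ cong (λ t → lookupOr z (w ++ ys) (t + r)) (sym ∣w∣≡N) ⟩
      lookupOr z (w ++ ys) (length w + r)  ≡⟨ lookupOr-++ʳ z w ys r ⟩
      lookupOr z ys r                      ≡⟨ hys r (+-cancelˡ-< N r M (subst (_< N + M) (sym j≡N+r) j<N+M)) ⟩
      cyclic r                             ≡⟨ cong (lookupOr z w) (trans (sym ([m+n]%n≡m%n r N)) (cong (_% N) (+-comm r N))) ⟩
      cyclic (N + r)                       ≡⟨ cong cyclic j≡N+r ⟩
      cyclic j                             ∎
      where
      open ≡-Reasoning
      r = j ∸ N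
      j≡N+r : N + r ≡ j
      j≡N+r = m+[n∸m]≡n (≮⇒≥ j≮N)

  lookupOr-triple : ∀ j → j < N + (N + N) → lookupOr z (w ++ w ++ w) j ≡ cyclic j
  lookupOr-triple = periodic-++ (w ++ w) (N + N) (periodic-++ w N periodic)

  module _ (s≤2N : ∀ c → s c ≤ N + N) (spaced-www : T (spaced (w ++ w ++ w))) where

    cyclic-spaced : ∀ p d → 0 < d → d ≤ s (cyclic p) → cyclic (p + d) ≢ cyclic p
    cyclic-spaced p d 0<d d≤s eq =
      spaced-sound z (w ++ w ++ w) spaced-www 0<d (subst (λ c → d ≤ s c) (sym at-q) d≤s) q+d<∣www∣
        (trans at-q+d (trans eq (sym at-q)))
      where
      q = p % N
      q≈p : q ≈ p
      q≈p = m%n%n≡m%n p N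
      q+d<3N : q + d < N + (N + N)
      q+d<3N = +-mono-<-≤ (m%n<n p N) (≤-trans d≤s (s≤2N (cyclic p)))
      at-q : lookupOr z (w ++ w ++ w) q ≡ cyclic p
      at-q = trans (lookupOr-triple q (≤-trans (m%n<n p N) (m≤m+n N _))) (cong (lookupOr z w) q≈p)
      at-q+d : lookupOr z (w ++ w ++ w) (q + d) ≡ cyclic (p + d)
      at-q+d = trans (lookupOr-triple (q + d) q+d<3N) (cong (lookupOr z w) (≈-+ʳ d q≈p))
      q+d<∣www∣ : q + d < length (w ++ w ++ w)
      q+d<∣www∣ = subst (q + d <_)
        (sym (trans (length-++ w) (cong₂ _+_ ∣w∣≡N (trans (length-++ w) (cong₂ _+_ ∣w∣≡N ∣w∣≡N))))) q+d<3N

    module _ (classes : ∀ c → lookup S c ≤ s c ⊎ All (_≢ c) (drop 1 w)) where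

      private
        forward : ∀ {d} p q → cyclic p ≡ cyclic q → ¬ p ≈ q → d ≤ lookup S (cyclic p) → ¬ p + d ≈ q
        forward p q same p≉q d≤S p+d≈q with classes (cyclic p)
        ... | inj₂ once = p≉q (trans (at0 p refl) (sym (at0 q (sym same))))
          where
          at0 : ∀ x → cyclic x ≡ cyclic p → x % N ≡ 0
          at0 x = lookupOr-head-only z w once (subst (x % N <_) (sym ∣w∣≡N) (m%n<n x N))
        forward {zero}  p q same p≉q d≤S p+d≈q | inj₁ S≤s =
          p≉q (trans (cong (_% N) (sym (+-identityʳ p))) p+d≈q)
        forward {suc d} p q same p≉q d≤S p+d≈q | inj₁ S≤s =
          cyclic-spaced p (suc d) (s≤s z≤n) (≤-trans d≤S S≤s) (trans (cong (lookupOr z w) p+d≈q) (sym same))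

      cyclic-packing : CyclicPacking S cyclic
      cyclic-packing p q same p≉q (d , d≤S , inj₁ p+d≈q) = forward p q same p≉q d≤S p+d≈q
      cyclic-packing p q same p≉q (d , d≤S , inj₂ q+d≈p) =
        forward q p (sym same) (p≉q ∘ sym) (subst (λ c → d ≤ lookup S c) same d≤S) q+d≈p

record PackingWord (S : List ℕ) (s : Fin (length S) → ℕ) (N : ℕ) : Set where
  field
    word     : List (Fin (length S))
    length≡N : length word ≡ N
    spaced³  : T (Spacing.spaced s (word ++ word ++ word))
    -- Each colour keeps its distance within the checked spacing s, or occurs only at position 0
    -- and so colours at most one vertex.
    classes  : ∀ c → lookup S c ≤ s c ⊎ All (_≢ c) (drop 1 word)

layout-word-packing : ∀ {G N s₀ S s} .{{_ : NonZero N}} → CyclicLayout G N → (∀ c → s c ≤ N + N) →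
                      PackingWord (s₀ ∷ S) s N → PackingColorable G (s₀ ∷ S)
layout-word-packing {N = N} {s₀} {S} {s} L s≤2N W =
  layout-packing L cyclic (cyclic-packing s≤2N spaced³ classes)
  where
  open PackingWord W
  open CyclicWord (s₀ ∷ S) s N zero word length≡N

blockWord : ∀ {S s} m (s≤m : ∀ c → s c ≤ m) {n} (blk : Fin n → List (Fin (length S))) →
            Spacing.Window.Compatible s m s≤m blk → ∀ ids →
            (∀ c → lookup S c ≤ s c ⊎ All (_≢ c) (drop 1 (concat (map blk ids)))) →
            PackingWord S s (length (concat (map blk ids)))
blockWord {s = s} m s≤m blk ok ids classes = record
  { word = concat (map blk ids) ; length≡N = refl
  ; spaced³ = Spacing.Window.spaced-cycle s m s≤m blk ok ids ; classes = classes }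

module Packing₁₁ₖ (k : ℕ) where

  S : List ℕ
  S = 1 ∷ 1 ∷ k ∷ []

  s : Fin 3 → ℕ
  s = lookup (1 ∷ 1 ∷ 0 ∷ [])

  s≤1 : ∀ c → s c ≤ 1
  s≤1 zero             = ≤-refl
  s≤1 (suc zero)       = ≤-refl
  s≤1 (suc (suc zero)) = z≤n

  blk : Fin 2 → List (Fin 3)
  blk zero       = # 0 ∷ # 1 ∷ []
  blk (suc zero) = # 2 ∷ # 0 ∷ # 1 ∷ []

  size : Fin 2 → ℕ
  size = length ∘ blk

  parity : ∀ m → Σ (Fin 2) λ b → Σ ℕ λ x → sum (map size (b ∷ replicate x zero)) ≡ 3 + m
  parity zero          = suc zero , 0 , refl
  parity (suc zero)    = zero , 1 , refl
  parity (suc (suc m)) with parity m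
  ... | b , x , eq = b , suc x , trans (x∙yz≈y∙xz (size b) 2 _) (cong (2 +_) eq)

  word : ∀ m → PackingWord S s (3 + m)
  word m with parity m
  ... | b , x , eq = subst (PackingWord S s) (trans (length-concat-map blk size (λ _ → refl) ids) eq)
                       (blockWord 1 s≤1 blk fits ids classes)
    where
    ids = b ∷ replicate x zero
    fits : Spacing.Window.Compatible s 1 s≤1 blk
    fits = from-yes (Spacing.Window.compatible? s 1 s≤1 blk)
    tail-avoids-2 : ∀ b {R} → All (_≢ # 2) R → All (_≢ # 2) (drop 1 (blk b ++ R))
    tail-avoids-2 zero       h = (λ ()) ∷ h
    tail-avoids-2 (suc zero) h = (λ ()) ∷ (λ ()) ∷ h
    classes : ∀ c → lookup S c ≤ s c ⊎ All (_≢ c) (drop 1 (concat (map blk ids)))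
    classes zero             = inj₁ ≤-refl
    classes (suc zero)       = inj₁ ≤-refl
    classes (suc (suc zero)) =
      inj₂ (tail-avoids-2 b (All.concat⁺ (All.map⁺ (All.replicate⁺ x ((λ ()) ∷ (λ ()) ∷ [])))))

size₃₄ : Fin 2 → ℕ
size₃₄ zero       = 3
size₃₄ (suc zero) = 4

threesAndFours : ∀ m → 3 + m ≢ 5 → Σ (List (Fin 2)) λ ids → sum (map size₃₄ ids) ≡ 3 + m
threesAndFours 0 _   = zero ∷ [] , refl
threesAndFours 1 _   = suc zero ∷ [] , refl
threesAndFours 2 ≢5  = ⊥-elim (≢5 refl)
threesAndFours 3 _   = zero ∷ zero ∷ [] , refl
threesAndFours 4 _   = zero ∷ suc zero ∷ [] , refl
threesAndFours 5 _   = suc zero ∷ suc zero ∷ [] , refl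
threesAndFours (suc (suc (suc m@(suc (suc (suc _)))))) _ with threesAndFours m (λ ())
... | ids , eq = zero ∷ ids , cong (3 +_) eq

threeFourWord : ∀ {S} (s≤2 : ∀ c → lookup S c ≤ 2) (blk : Fin 2 → List (Fin (length S))) →
                (∀ b → length (blk b) ≡ size₃₄ b) → Spacing.Window.Compatible (lookup S) 2 s≤2 blk →
                ∀ m → 3 + m ≢ 5 → PackingWord S (lookup S) (3 + m)
threeFourWord {S} s≤2 blk ∣blk∣ fits m ≢5 with threesAndFours m ≢5
... | ids , eq = subst (PackingWord S (lookup S)) (trans (length-concat-map blk size₃₄ ∣blk∣ ids) eq)
                   (blockWord 2 s≤2 blk fits ids (λ _ → inj₁ ≤-refl))

module Packing₁₂₂ where

  s≤2 : ∀ c → lookup (1 ∷ 2 ∷ 2 ∷ []) c ≤ 2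
  s≤2 zero             = s≤s z≤n
  s≤2 (suc zero)       = ≤-refl
  s≤2 (suc (suc zero)) = ≤-refl

  blk : Fin 2 → List (Fin 3)
  blk zero       = # 0 ∷ # 1 ∷ # 2 ∷ []
  blk (suc zero) = # 0 ∷ # 1 ∷ # 0 ∷ # 2 ∷ []

  word : ∀ m → 3 + m ≢ 5 → PackingWord (1 ∷ 2 ∷ 2 ∷ []) (lookup (1 ∷ 2 ∷ 2 ∷ [])) (3 + m)
  word = threeFourWord s≤2 blk (λ { zero → refl ; (suc zero) → refl })
                       (from-yes (Spacing.Window.compatible? _ 2 s≤2 blk))

module Packing₂₂₂₂ where

  s≤2 : ∀ c → lookup (2 ∷ 2 ∷ 2 ∷ 2 ∷ []) c ≤ 2
  s≤2 zero                   = ≤-refl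
  s≤2 (suc zero)             = ≤-refl
  s≤2 (suc (suc zero))       = ≤-refl
  s≤2 (suc (suc (suc zero))) = ≤-refl

  blk : Fin 2 → List (Fin 4)
  blk zero       = # 0 ∷ # 1 ∷ # 2 ∷ []
  blk (suc zero) = # 0 ∷ # 1 ∷ # 2 ∷ # 3 ∷ []

  word : ∀ m → 3 + m ≢ 5 → PackingWord (2 ∷ 2 ∷ 2 ∷ 2 ∷ []) (lookup (2 ∷ 2 ∷ 2 ∷ 2 ∷ [])) (3 + m)
  word = threeFourWord s≤2 blk (λ { zero → refl ; (suc zero) → refl })
                       (from-yes (Spacing.Window.compatible? _ 2 s≤2 blk))

-- A word is a head 4 ∷ h followed by copies of the period 0 1 0 2 0 1 0 3. The eight heads have
-- lengths 6, 7, 8, 9, 12, 13, 18, 19, one in each residue class mod 8, which covers N = 6, …, 9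
-- and every N ≥ 12; the lengths 3, 4, 5, 10, 11 get explicit words.
module Packing₁₂₄₅ₖ (k : ℕ) where

  S : List ℕ
  S = 1 ∷ 2 ∷ 4 ∷ 5 ∷ k ∷ []

  s : Fin 5 → ℕ
  s = lookup (1 ∷ 2 ∷ 4 ∷ 5 ∷ 0 ∷ [])

  s≤5 : ∀ c → s c ≤ 5
  s≤5 zero                         = s≤s z≤n
  s≤5 (suc zero)                   = s≤s (s≤s z≤n)
  s≤5 (suc (suc zero))             = s≤s (s≤s (s≤s (s≤s z≤n)))
  s≤5 (suc (suc (suc zero)))       = ≤-refl
  s≤5 (suc (suc (suc (suc zero)))) = z≤n

  avoids4? : (xs : List (Fin 5)) → Dec (All (_≢ # 4) xs)
  avoids4? = all? (λ y → ¬? (y Fin.≟ # 4))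

  period : List (Fin 5)
  period = # 0 ∷ # 1 ∷ # 0 ∷ # 2 ∷ # 0 ∷ # 1 ∷ # 0 ∷ # 3 ∷ []

  heads : List (List (Fin 5))
  heads = a
        ∷ b
        ∷ (# 0 ∷ # 1 ∷ # 0 ∷ # 2 ∷ # 0 ∷ # 1 ∷ # 3 ∷ [])
        ∷ period
        ∷ (a ++ b)
        ∷ (b ++ b)
        ∷ (a ++ b ++ b)
        ∷ (b ++ b ++ b)
        ∷ []
    where
    a b : List (Fin 5)
    a = # 0 ∷ # 1 ∷ # 0 ∷ # 2 ∷ # 3 ∷ []
    b = # 0 ∷ # 1 ∷ # 0 ∷ # 2 ∷ # 0 ∷ # 3 ∷ []

  blk : Fin 8 → Fin 2 → List (Fin 5)
  blk t zero       = period
  blk t (suc zero) = # 4 ∷ lookup heads t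

  size : Fin 8 → Fin 2 → ℕ
  size t = length ∘ blk t

  classes : ∀ w → All (_≢ # 4) (drop 1 w) → ∀ c → lookup S c ≤ s c ⊎ All (_≢ c) (drop 1 w)
  classes _ _      zero                         = inj₁ ≤-refl
  classes _ _      (suc zero)                   = inj₁ ≤-refl
  classes _ _      (suc (suc zero))             = inj₁ ≤-refl
  classes _ _      (suc (suc (suc zero)))       = inj₁ ≤-refl
  classes _ avoids (suc (suc (suc (suc zero)))) = inj₂ avoids

  explicit : (w : List (Fin 5)) → {T (Spacing.spaced s (w ++ w ++ w))} → {True (avoids4? (drop 1 w))} →
             PackingWord S s (length w)
  explicit w {spaced³} {avoids} =
    record { word = w ; length≡N = refl ; spaced³ = spaced³ ; classes = classes w (toWitness avoids) }

  residueWord : ∀ t a → PackingWord S s (sum (map (size t) (suc zero ∷ replicate a zero)))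
  residueWord t a = subst (PackingWord S s) (length-concat-map (blk t) (size t) (λ _ → refl) ids)
                      (blockWord 5 s≤5 (blk t) (compatible t) ids
                        (classes (concat (map (blk t) ids)) (All.++⁺ (heads-avoid t) periods-avoid)))
    where
    ids = suc zero ∷ replicate a zero
    compatible : ∀ t → Spacing.Window.Compatible s 5 s≤5 (blk t)
    compatible = from-yes (Fin.all? λ t → Spacing.Window.compatible? s 5 s≤5 (blk t))
    heads-avoid : ∀ t → All (_≢ # 4) (lookup heads t)
    heads-avoid = from-yes (Fin.all? λ t → avoids4? (lookup heads t))
    periods-avoid : All (_≢ # 4) (concat (map (blk t) (replicate a zero)))
    periods-avoid = All.concat⁺ (All.map⁺ (All.replicate⁺ a (from-yes (avoids4? period))))

  residue : ∀ n → Σ (Fin 8) λ t → Σ ℕ λ a → sum (map (size t) (suc zero ∷ replicate a zero)) ≡ 12 + n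
  residue 0 = # 4 , 0 , refl
  residue 1 = # 5 , 0 , refl
  residue 2 = # 0 , 1 , refl
  residue 3 = # 1 , 1 , refl
  residue 4 = # 2 , 1 , refl
  residue 5 = # 3 , 1 , refl
  residue 6 = # 6 , 0 , refl
  residue 7 = # 7 , 0 , refl
  residue (suc (suc (suc (suc (suc (suc (suc (suc n)))))))) with residue n
  ... | t , a , eq = t , suc a , trans (x∙yz≈y∙xz (size t (suc zero)) 8 _) (cong (8 +_) eq)

  word : ∀ m → PackingWord S s (3 + m)
  word 0 = explicit (# 4 ∷ # 0 ∷ # 1 ∷ [])
  word 1 = explicit (# 4 ∷ # 0 ∷ # 1 ∷ # 0 ∷ [])
  word 2 = explicit (# 4 ∷ # 0 ∷ # 1 ∷ # 0 ∷ # 2 ∷ [])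
  word 3 = residueWord (# 0) 0
  word 4 = residueWord (# 1) 0
  word 5 = residueWord (# 2) 0
  word 6 = residueWord (# 3) 0
  word 7 = explicit (# 4 ∷ # 0 ∷ # 1 ∷ # 0 ∷ # 2 ∷ # 0 ∷ # 1 ∷ # 0 ∷ # 3 ∷ # 0 ∷ [])
  word 8 = explicit (# 4 ∷ # 0 ∷ # 1 ∷ # 0 ∷ # 2 ∷ # 0 ∷ # 1 ∷ # 0 ∷ # 3 ∷ # 0 ∷ # 1 ∷ [])
  word (suc (suc (suc (suc (suc (suc (suc (suc (suc n))))))))) with residue n
  ... | t , a , eq = subst (PackingWord S s) eq (residueWord t a)

lemma1 : (G : Graph) → Connected G → MaxDeg≤ G 2 →
    ((k : ℕ) → 1 ≤ k → PackingColorable G (1 ∷ 1 ∷ k ∷ []))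
    × (¬ IsC5 G → PackingColorable G (1 ∷ 2 ∷ 2 ∷ []))
    × (¬ IsC5 G → PackingColorable G (2 ∷ 2 ∷ 2 ∷ 2 ∷ []))
    × ((k : ℕ) → 6 ≤ k → PackingColorable G (1 ∷ 2 ∷ 4 ∷ 5 ∷ k ∷ []))
lemma1 G conn Δ≤2 with cyclicLayout G conn Δ≤2
... | m , L , isC5 =
  (λ k _ → layout-word-packing L (within (Packing₁₁ₖ.s≤1 k) (s≤s z≤n)) (Packing₁₁ₖ.word k m)) ,
  (λ ¬C5 → layout-word-packing L (within Packing₁₂₂.s≤2 (s≤s (s≤s z≤n)))
                                  (Packing₁₂₂.word m (¬C5 ∘ isC5))) ,
  (λ ¬C5 → layout-word-packing L (within Packing₂₂₂₂.s≤2 (s≤s (s≤s z≤n)))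
                                  (Packing₂₂₂₂.word m (¬C5 ∘ isC5))) ,
  (λ k _ → layout-word-packing L (within (Packing₁₂₄₅ₖ.s≤5 k) ≤-refl) (Packing₁₂₄₅ₖ.word k m))
  where
  within : ∀ {k} {s : Fin k → ℕ} {w} → (∀ c → s c ≤ w) → w ≤ 5 → ∀ c → s c ≤ 3 + m + (3 + m)
  within s≤w w≤5 c = ≤-trans (s≤w c) (≤-trans w≤5 (≤-trans (n≤1+n 5) (+-mono-≤ 3≤N 3≤N)))
    where
    3≤N = m≤m+n 3 m
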